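{- Let $G$ be a finite group. The maximum weight of a directed path in $\vec{C}(G)$ (the sum of the weights of its vertices) equals the maximum length (number of vertices) of a directed path in the directed power graph $\vec{\mathfrak{g}}(G)$.
   Context: The directed power graph $\vec{\mathfrak{g}}(G)$ has vertex set $G$ and a directed edge $(x,y)$ whenever $x\ne y$ and $\langle y\rangle\le\langle x\rangle$. Define $x\sim y$ iff $\langle x\rangle=\langle y\rangle$. The directed graph $\vec{C}(G)$ has vertex set $G/\!\sim$ and a directed edge $(A,B)$ iff there exist $a\in A$, $b\in B$ with $\langle b\rangle\le\langle a\rangle$ and $\langle b\rangle\ne\langle a\rangle$; each vertex $A$ has weight $w(A)=|A|$. Directed paths consist of distinct vertices, each joined to the next by a directed edge. -}

module Defs where

open import Level using (Level; _⊔_)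
open import Data.Nat using (ℕ; zero; suc; _+_; _≤_)
open import Data.Integer using (ℤ; +_; -[1+_])
open import Data.Fin using (Fin)
open import Data.List using (List; []; _∷_; length)
open import Data.List.Relation.Unary.All using (All)
open import Data.List.Relation.Unary.Any using (Any)
open import Data.List.Relation.Unary.AllPairs using (AllPairs)
open import Data.List.Relation.Unary.Linked using (Linked)
open import Data.Product using (Σ; ∃; ∃-syntax; _×_)
open import Relation.Nullary using (¬_)
open import Relation.Binary.PropositionalEquality using (_≡_)
import Relation.Binary.PropositionalEquality as ≡
open import Function.Bundles using (Inverse)
open import Algebra.Bundles using (Group)

IsFiniteGroup : ∀ {c ℓ} → Group c ℓ → Set (c ⊔ ℓ)
IsFiniteGroup G = Σ ℕ λ n → Inverse (≡.setoid (Fin n)) (Group.setoid G)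

module _ {c ℓ} (G : Group c ℓ) where
  open Group G

  _^ℕ_ : Carrier → ℕ → Carrier
  x ^ℕ zero  = ε
  x ^ℕ suc k = x ∙ (x ^ℕ k)

  _^ℤ_ : Carrier → ℤ → Carrier
  x ^ℤ (+ k)      = x ^ℕ k
  x ^ℤ (-[1+ k ]) = (x ^ℕ suc k) ⁻¹

  _∈⟨_⟩ : Carrier → Carrier → Set ℓ
  y ∈⟨ x ⟩ = ∃[ k ] (y ≈ x ^ℤ k)

  _⊆C_ : Carrier → Carrier → Set (c ⊔ ℓ)
  y ⊆C x = ∀ z → z ∈⟨ y ⟩ → z ∈⟨ x ⟩

  _∼_ : Carrier → Carrier → Set (c ⊔ ℓ)
  x ∼ y = (x ⊆C y) × (y ⊆C x)

  PowerEdge : Carrier → Carrier → Set (c ⊔ ℓ)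
  PowerEdge x y = (¬ (x ≈ y)) × (y ⊆C x)

  PowerPath : List Carrier → Set (c ⊔ ℓ)
  PowerPath p = AllPairs (λ a b → ¬ (a ≈ b)) p × Linked PowerEdge p

  -- Vertices of C(G) are ∼-classes, represented by any representative.
  -- Edge (A , B): ∃ a ∈ A, b ∈ B with ⟨b⟩ ≤ ⟨a⟩ and ⟨b⟩ ≠ ⟨a⟩.
  CEdge : Carrier → Carrier → Set (c ⊔ ℓ)
  CEdge x y = ∃[ a ] ∃[ b ] ((a ∼ x) × (b ∼ y) × (b ⊆C a) × (¬ (b ∼ a)))

  CPath : List Carrier → Set (c ⊔ ℓ)
  CPath p = AllPairs (λ a b → ¬ (a ∼ b)) p × Linked CEdge p

  ClassSize : Carrier → ℕ → Set (c ⊔ ℓ)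
  ClassSize x m = ∃[ l ] ((length l ≡ m) × All (λ y → y ∼ x) l
                   × AllPairs (λ a b → ¬ (a ≈ b)) l
                   × (∀ y → y ∼ x → Any (λ z → y ≈ z) l))

  data PathWeight : List Carrier → ℕ → Set (c ⊔ ℓ) where
    []  : PathWeight [] 0
    _∷_ : ∀ {x p m w} → ClassSize x m → PathWeight p w → PathWeight (x ∷ p) (m + w)

  IsMaxPowerPathLength : ℕ → Set (c ⊔ ℓ)
  IsMaxPowerPathLength L =
    (∃[ p ] (PowerPath p × length p ≡ L)) × (∀ p → PowerPath p → length p ≤ L)

  IsMaxCPathWeight : ℕ → Set (c ⊔ ℓ)
  IsMaxCPathWeight W =
    (∃[ p ] (CPath p × PathWeight p W)) × (∀ p w → CPath p → PathWeight p w → w ≤ W)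

-- A power path x₁ → x₂ → … descends through the cyclic subgroups ⟨x₁⟩ ≥ ⟨x₂⟩ ≥ …, and so does a
-- path in C(G): read through representatives, each is exactly a list whose relation holds between
-- ALL pairs, not just consecutive ones. Keeping one element of each ∼-class met by a power path
-- gives a path in C(G) whose classes cover the (repetition-free) power path, so its weight is at
-- least the length. Conversely, listing the classes of a path in C(G) one after another gives a
-- power path whose length is exactly the weight. That maximum exists constructively: every element has
-- order at most n = |G|, so ⟨y⟩ ≤ ⟨x⟩ just says y ∈ {x⁰, …, xⁿ⁻¹}, which is decidable, and so is
-- the existence of a power path of each length k ≤ n.

module Submission where

open import Defs
open import Level using (_⊔_)
open import Algebra.Bundles using (Group)
open import Data.Nat using (ℕ; zero; suc; _+_; _*_; _∸_; _≤_; _<_; NonZero; >-nonZero)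
open import Data.Nat.Properties
  using (n<1+n; m<n⇒0<n∸m; ≤-trans; <-≤-trans; m∸n≤m; ≤-pred; ≤∧≢⇒<; <⇒≤; m∸n+n≡m; m≤m*n; ≤-antisym)
open import Data.Nat.DivMod using (_%_; _/_; m≡m%n+[m/n]*n; m%n<n)
open import Data.Integer using (+_; -[1+_])
open import Data.Fin as Fin using (Fin; toℕ; fromℕ<)
open import Data.Fin.Properties using (any?; pigeonhole; injective⇒≤; toℕ<n; toℕ-fromℕ<)
open import Data.List as List
  using (List; []; _∷_; _++_; length; lookup; filter; deduplicate; concatMap; tabulate)
open import Data.List.Properties using (length-map; length-tabulate; length-++)
open import Data.List.Membership.Propositional using () renaming (_∈_ to _∈ₚ_)
open import Data.List.Membership.Propositional.Properties using (∈-lookup)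
open import Data.List.Relation.Unary.All as All using (All; []; _∷_)
open import Data.List.Relation.Unary.All.Properties as All using (all-filter)
open import Data.List.Relation.Unary.Any as Any using (Any; here; there)
import Data.List.Relation.Unary.Any.Properties as Any
open import Data.List.Relation.Unary.AllPairs as AllPairs using (AllPairs; []; _∷_)
import Data.List.Relation.Unary.AllPairs.Properties as AllPairs
import Data.List.Relation.Unary.Linked as Linked
open import Data.List.Relation.Unary.Linked.Properties using (Linked⇒AllPairs; AllPairs⇒Linked)
open import Data.Product using (∃; ∃-syntax; _×_; _,_; proj₁; proj₂)
open import Data.Empty using (⊥-elim)
open import Function using (_∘_)
open import Function.Bundles using (Inverse; Equivalence; _⇔_; mk⇔)
import Function.Properties.Equivalence as ⇔
open import Relation.Binary using (Rel; Setoid; Decidable)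
open import Relation.Binary.PropositionalEquality as ≡ using (_≡_)
open import Relation.Nullary using (¬_; ¬?; Dec; yes; no)
open import Relation.Nullary.Decidable as Dec using (map′; _×-dec_)
open import Relation.Unary using (Pred)

module _ {a ℓ} (S : Setoid a ℓ) where
  open Setoid S using (_≈_; sym)
  open import Data.List.Relation.Unary.Unique.Setoid S using (Unique)
  open import Data.List.Membership.Setoid S using (_∈_)
  open import Data.List.Membership.Setoid.Properties using (index-injective)

  unique-lookup-injective : ∀ {xs} → Unique xs → ∀ {i j} → lookup xs i ≈ lookup xs j → i ≡ j
  unique-lookup-injective (_ ∷ _)  {Fin.zero}  {Fin.zero}  _ = ≡.refl
  unique-lookup-injective (x∉ ∷ _) {Fin.zero}  {Fin.suc j} x≈ = ⊥-elim (All.lookup x∉ (∈-lookup j) x≈)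
  unique-lookup-injective (x∉ ∷ _) {Fin.suc i} {Fin.zero}  ≈x = ⊥-elim (All.lookup x∉ (∈-lookup i) (sym ≈x))
  unique-lookup-injective (_ ∷ u)  {Fin.suc i} {Fin.suc j} eq = ≡.cong Fin.suc (unique-lookup-injective u eq)

  unique⇒length≤ : ∀ {xs ys} → Unique xs → All (_∈ ys) xs → length xs ≤ length ys
  unique⇒length≤ {xs} u xs⊆ys = injective⇒≤ {f = position} λ {i} {j} same →
      unique-lookup-injective u (index-injective S (member i) (member j) same)
    where
    member : ∀ i → lookup xs i ∈ _
    member i = All.lookup xs⊆ys (∈-lookup i)
    position : Fin (length xs) → Fin _
    position = Any.index ∘ member

allPairs-deduplicate⁺ : ∀ {a r s} {A : Set a} {R : Rel A r} {S : Rel A s} (S? : Decidable S) {xs} →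
                        AllPairs R xs → AllPairs (λ x y → R x y × ¬ S x y) (deduplicate S? xs)
allPairs-deduplicate⁺ S? []                 = []
allPairs-deduplicate⁺ S? {x ∷ xs} (Rx ∷ Rxs) =
  All.zip (All.filter⁺ (¬? ∘ S? x) (All.deduplicate⁺ S? Rx) ,
           all-filter (¬? ∘ S? x) (deduplicate S? xs))
  ∷ AllPairs.filter⁺ (¬? ∘ S? x) (allPairs-deduplicate⁺ S? Rxs)

bounded-maximum : ∀ {p} {P : Pred ℕ p} → (∀ k → Dec (P k)) →
                  ∀ b → (∀ {k} → P k → k ≤ b) → P 0 → ∃[ m ] (P m × ∀ {k} → P k → k ≤ m)
bounded-maximum P? zero    bound P0 = 0 , P0 , bound
bounded-maximum {P = P} P? (suc b) bound P0 with P? (suc b)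
... | yes Pb = suc b , Pb , bound
... | no ¬Pb = bounded-maximum P? b below-b P0
  where
  below-b : ∀ {k} → P k → k ≤ b
  below-b Pk = ≤-pred (≤∧≢⇒< (bound Pk) λ k≡1+b → ¬Pb (≡.subst P k≡1+b Pk))

module FinitelyEnumerable {a ℓ} {S : Setoid a ℓ} {n} (enumeration : Inverse (≡.setoid (Fin n)) S) where
  open Setoid S using (Carrier; _≈_; sym; trans; reflexive)
  open Inverse enumeration using (to; from; from-cong; inverseˡ; inverseʳ)
  open import Data.List.Relation.Unary.Unique.Setoid S using (Unique)
  open import Data.List.Membership.Setoid S using (_∈_)
  open import Data.List.Membership.Setoid.Properties using (∈-resp-≈; ∈-tabulate⁺)

  to-from : ∀ x → to (from x) ≈ x
  to-from x = inverseˡ ≡.refl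

  from-injective : ∀ {x y} → from x ≡ from y → x ≈ y
  from-injective {x} {y} e = trans (sym (to-from x)) (trans (reflexive (≡.cong to e)) (to-from y))

  from-to : ∀ i → from (to i) ≡ i
  from-to i = inverseʳ (Setoid.refl S)

  to-injective : ∀ {i j} → to i ≈ to j → i ≡ j
  to-injective {i} {j} e = ≡.trans (≡.sym (from-to i)) (≡.trans (from-cong e) (from-to j))

  infix 4 _≟_

  _≟_ : Decidable _≈_
  x ≟ y = map′ from-injective from-cong (from x Fin.≟ from y)

  elements : List Carrier
  elements = tabulate to

  ∈-elements : ∀ x → x ∈ elements
  ∈-elements x = ∈-resp-≈ S (to-from x) (∈-tabulate⁺ S (from x))

  elements-unique : Unique elements
  elements-unique = AllPairs.tabulate⁺ λ i≢j e → i≢j (to-injective e)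

  unique⇒length≤n : ∀ {xs} → Unique xs → length xs ≤ n
  unique⇒length≤n u =
    ≡.subst (_ ≤_) (length-tabulate to) (unique⇒length≤ S u (All.tabulate λ _ → ∈-elements _))

  any-ofLength? : ∀ {q} {Q : Pred (List (Fin n)) q} → (∀ is → Dec (Q is)) →
                  ∀ k → Dec (∃[ is ] (length is ≡ k × Q is))
  any-ofLength? Q? zero    =
    map′ (λ Q[] → [] , ≡.refl , Q[]) (λ { ([] , ≡.refl , Q[]) → Q[] }) (Q? [])
  any-ofLength? Q? (suc k) =
    map′ (λ { (i , is , ≡.refl , Q[i∷is]) → i ∷ is , ≡.refl , Q[i∷is] })
         (λ { (i ∷ is , ≡.refl , Q[i∷is]) → i , is , ≡.refl , Q[i∷is] })
         (any? λ i → any-ofLength? (Q? ∘ (i ∷_)) k)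

  module _ {r} {R : Rel Carrier r} (R? : Decidable R)
           (R-resp : ∀ {x x′ y y′} → x ≈ x′ → y ≈ y′ → R x y → R x′ y′)
           (R⇒≉ : ∀ {x y} → R x y → ¬ x ≈ y) where

    Chain : ℕ → Set (a ⊔ r)
    Chain k = ∃[ xs ] (AllPairs R xs × length xs ≡ k)

    -- Every chain can be replaced by one whose entries are of the form to i.
    chain? : ∀ k → Dec (Chain k)
    chain? k = map′ (λ { (is , ≡.refl , R[is]) → List.map to is , R[is] , length-map to is })
                    (λ { (xs , R[xs] , ≡.refl) → List.map from xs , length-map from xs , normalise R[xs] })
                    (any-ofLength? (λ is → AllPairs.allPairs? R? (List.map to is)) k)
      where
      normalise : ∀ {xs} → AllPairs R xs → AllPairs R (List.map to (List.map from xs))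
      normalise =
        AllPairs.map⁺ ∘ AllPairs.map⁺ ∘ AllPairs.map (R-resp (sym (to-from _)) (sym (to-from _)))

    longest-chain : ∃[ L ] (Chain L × ∀ {xs} → AllPairs R xs → length xs ≤ L)
    longest-chain =
      let L , chainL , maximal = bounded-maximum chain? n chain≤n ([] , [] , ≡.refl)
      in L , chainL , λ R[xs] → maximal (_ , R[xs] , ≡.refl)
      where
      chain≤n : ∀ {k} → Chain k → k ≤ n
      chain≤n (_ , R[xs] , ≡.refl) = unique⇒length≤n (AllPairs.map R⇒≉ R[xs])

module FiniteGroup {c ℓ} (G : Group c ℓ) {n} (enumeration : Inverse (≡.setoid (Fin n)) (Group.setoid G)) where
  open Group G
  open import Algebra.Properties.Group G using (∙-cancelʳ; inverseˡ-unique)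
  open import Relation.Binary.Reasoning.Setoid setoid
  open import Data.List.Membership.Setoid setoid using (_∈_)
  open import Data.List.Membership.Setoid.Properties using (∈-filter⁺; ∈-concat⁺)
  open Inverse enumeration using (from)
  open FinitelyEnumerable enumeration

  infixr 8 _^_

  _^_ : Carrier → ℕ → Carrier
  _^_ = _^ℕ_ G

  ^-congˡ : ∀ {x y} k → x ≈ y → x ^ k ≈ y ^ k
  ^-congˡ zero    x≈y = refl
  ^-congˡ (suc k) x≈y = ∙-cong x≈y (^-congˡ k x≈y)

  ^-+ : ∀ x a b → x ^ (a + b) ≈ x ^ a ∙ x ^ b
  ^-+ x zero    b = sym (identityˡ _)
  ^-+ x (suc a) b = trans (∙-congˡ (^-+ x a b)) (sym (assoc _ _ _))

  ^-* : ∀ x a b → (x ^ a) ^ b ≈ x ^ (b * a)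
  ^-* x a zero    = refl
  ^-* x a (suc b) = trans (∙-congˡ (^-* x a b)) (sym (^-+ x a (b * a)))

  ε^ : ∀ k → ε ^ k ≈ ε
  ε^ zero    = refl
  ε^ (suc k) = trans (identityˡ _) (ε^ k)

  ^ℤ-congˡ : ∀ {x y} k → x ≈ y → _^ℤ_ G x k ≈ _^ℤ_ G y k
  ^ℤ-congˡ (+ k)    = ^-congˡ k
  ^ℤ-congˡ -[1+ k ] x≈y = ⁻¹-cong (^-congˡ (suc k) x≈y)

  -- Two of the n + 1 powers x ^ 0, …, x ^ n coincide.
  period : ∀ x → ∃[ d ] (NonZero d × d ≤ n × x ^ d ≈ ε)
  period x with pigeonhole (n<1+n n) (λ (i : Fin (suc n)) → from (x ^ toℕ i))
  ... | i , j , i<j , same =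
    d , >-nonZero (m<n⇒0<n∸m i<j) , ≤-trans (m∸n≤m (toℕ j) (toℕ i)) (≤-pred (toℕ<n j)) ,
    ∙-cancelʳ (x ^ toℕ i) _ _ (begin
      x ^ d ∙ x ^ toℕ i  ≈⟨ ^-+ x d (toℕ i) ⟨
      x ^ (d + toℕ i)    ≡⟨ ≡.cong (x ^_) (m∸n+n≡m (<⇒≤ i<j)) ⟩
      x ^ toℕ j          ≈⟨ from-injective same ⟨
      x ^ toℕ i          ≈⟨ identityˡ _ ⟨
      ε ∙ x ^ toℕ i      ∎)
    where d = toℕ j ∸ toℕ i

  module _ {x} d .{{_ : NonZero d}} (xᵈ≈ε : x ^ d ≈ ε) where

    ^[k*d]≈ε : ∀ k → x ^ (k * d) ≈ ε
    ^[k*d]≈ε k = trans (sym (^-* x d k)) (trans (^-congˡ k xᵈ≈ε) (ε^ k))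

    ^-mod : ∀ N → x ^ N ≈ x ^ (N % d)
    ^-mod N = begin
      x ^ N                          ≡⟨ ≡.cong (x ^_) (m≡m%n+[m/n]*n N d) ⟩
      x ^ (N % d + N / d * d)        ≈⟨ ^-+ x (N % d) (N / d * d) ⟩
      x ^ (N % d) ∙ x ^ (N / d * d)  ≈⟨ ∙-congˡ (^[k*d]≈ε (N / d)) ⟩
      x ^ (N % d) ∙ ε                ≈⟨ identityʳ _ ⟩
      x ^ (N % d)                    ∎

    ^-inverse : ∀ s → (x ^ s) ⁻¹ ≈ x ^ (s * d ∸ s)
    ^-inverse s = sym (inverseˡ-unique _ _ (begin
      x ^ (s * d ∸ s) ∙ x ^ s  ≈⟨ ^-+ x (s * d ∸ s) s ⟨
      x ^ (s * d ∸ s + s)      ≡⟨ ≡.cong (x ^_) (m∸n+n≡m (m≤m*n s d)) ⟩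
      x ^ (s * d)              ≈⟨ ^[k*d]≈ε s ⟩
      ε                        ∎))

    ^ℤ-natural : ∀ k → ∃[ N ] (_^ℤ_ G x k ≈ x ^ N)
    ^ℤ-natural (+ N)    = N , refl
    ^ℤ-natural -[1+ s ] = suc s * d ∸ suc s , ^-inverse (suc s)

  ^ℤ-reduce : ∀ x k → ∃[ r ] (r < n × _^ℤ_ G x k ≈ x ^ r)
  ^ℤ-reduce x k with period x
  ... | d , nz , d≤n , xᵈ≈ε = reduce d {{nz}} d≤n xᵈ≈ε
    where
    reduce : ∀ d .{{_ : NonZero d}} → d ≤ n → x ^ d ≈ ε → ∃[ r ] (r < n × _^ℤ_ G x k ≈ x ^ r)
    reduce d d≤n xᵈ≈ε =
      let N , xᵏ≈xᴺ = ^ℤ-natural d xᵈ≈ε k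
      in N % d , <-≤-trans (m%n<n N d) d≤n , trans xᵏ≈xᴺ (^-mod d xᵈ≈ε N)

  infix 4 _⊑_ _≃_ _⊏_

  _⊑_ : Carrier → Carrier → Set (c ⊔ ℓ)
  _⊑_ = _⊆C_ G

  _≃_ : Carrier → Carrier → Set (c ⊔ ℓ)
  _≃_ = _∼_ G

  _⊏_ : Carrier → Carrier → Set (c ⊔ ℓ)
  y ⊏ x = y ⊑ x × ¬ x ⊑ y

  ∈⟨⟩-refl : ∀ x → _∈⟨_⟩ G x x
  ∈⟨⟩-refl x = + 1 , sym (identityʳ x)

  ⊑-refl : ∀ {x} → x ⊑ x
  ⊑-refl _ z∈⟨x⟩ = z∈⟨x⟩

  ⊑-trans : ∀ {x y z} → x ⊑ y → y ⊑ z → x ⊑ z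
  ⊑-trans x⊑y y⊑z w w∈⟨x⟩ = y⊑z w (x⊑y w w∈⟨x⟩)

  ≈⇒⊑ : ∀ {x y} → x ≈ y → x ⊑ y
  ≈⇒⊑ x≈y z (k , z≈xᵏ) = k , trans z≈xᵏ (^ℤ-congˡ k x≈y)

  ≃-refl : ∀ {x} → x ≃ x
  ≃-refl = ⊑-refl , ⊑-refl

  ≃-sym : ∀ {x y} → x ≃ y → y ≃ x
  ≃-sym (x⊑y , y⊑x) = y⊑x , x⊑y

  ≃-trans : ∀ {x y z} → x ≃ y → y ≃ z → x ≃ z
  ≃-trans (x⊑y , y⊑x) (y⊑z , z⊑y) = ⊑-trans x⊑y y⊑z , ⊑-trans z⊑y y⊑x

  ≈⇒≃ : ∀ {x y} → x ≈ y → x ≃ y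
  ≈⇒≃ x≈y = ≈⇒⊑ x≈y , ≈⇒⊑ (sym x≈y)

  ⊏-trans : ∀ {x y z} → x ⊏ y → y ⊏ z → x ⊏ z
  ⊏-trans (x⊑y , y⋢x) (y⊑z , z⋢y) = ⊑-trans x⊑y y⊑z , λ z⊑x → z⋢y (⊑-trans z⊑x x⊑y)

  ⊑⇔power : ∀ {x y} → y ⊑ x ⇔ (∃ λ (r : Fin n) → y ≈ x ^ toℕ r)
  ⊑⇔power {x} {y} = mk⇔ power generated
    where
    power : y ⊑ x → ∃ λ (r : Fin n) → y ≈ x ^ toℕ r
    power y⊑x with y⊑x y (∈⟨⟩-refl y)
    ... | k , y≈xᵏ with ^ℤ-reduce x k
    ... | r , r<n , xᵏ≈xʳ =
      fromℕ< r<n , trans y≈xᵏ (trans xᵏ≈xʳ (reflexive (≡.cong (x ^_) (≡.sym (toℕ-fromℕ< r<n)))))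

    generated : (∃ λ (r : Fin n) → y ≈ x ^ toℕ r) → y ⊑ x
    generated (r , y≈xʳ) z (k , z≈yᵏ) with ^ℤ-reduce y k
    ... | N , _ , yᵏ≈yᴺ =
      + (N * toℕ r) , trans z≈yᵏ (trans yᵏ≈yᴺ (trans (^-congˡ N y≈xʳ) (^-* x (toℕ r) N)))

  _⊑?_ : Decidable _⊑_
  y ⊑? x = Dec.map (⇔.sym ⊑⇔power) (any? λ r → y ≟ x ^ toℕ r)

  _≃?_ : Decidable _≃_
  x ≃? y = (x ⊑? y) ×-dec (y ⊑? x)

  classOf : Carrier → List Carrier
  classOf x = filter (_≃? x) elements

  ∈-classOf : ∀ {x y} → y ≃ x → y ∈ classOf x
  ∈-classOf {x} {y} =
    ∈-filter⁺ setoid (_≃? x) (λ y≈y′ y≃x → ≃-trans (≈⇒≃ (sym y≈y′)) y≃x) (∈-elements y)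

  classOf-size : ∀ x → ClassSize G x (length (classOf x))
  classOf-size x = classOf x , ≡.refl , all-filter (_≃? x) elements ,
                   AllPairs.filter⁺ (_≃? x) elements-unique , λ _ → ∈-classOf

  concatMap-classOf-weight : ∀ q → PathWeight G q (length (concatMap classOf q))
  concatMap-classOf-weight []      = []
  concatMap-classOf-weight (x ∷ q) =
    ≡.subst (PathWeight G (x ∷ q)) (≡.sym (length-++ (classOf x)))
            (classOf-size x ∷ concatMap-classOf-weight q)

  powerPath⇔allPairs : ∀ {p} → PowerPath G p ⇔ AllPairs (PowerEdge G) p
  powerPath⇔allPairs = mk⇔
    (λ (distinct , edges) →
       AllPairs.zip (distinct , Linked⇒AllPairs (λ y⊑x z⊑y → ⊑-trans z⊑y y⊑x) (Linked.map proj₂ edges)))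
    (λ edges → AllPairs.map proj₁ edges , AllPairs⇒Linked edges)

  cEdge⇒⊏ : ∀ {x y} → CEdge G x y → y ⊏ x
  cEdge⇒⊏ (_ , _ , (a⊑x , _) , (_ , y⊑b) , b⊑a , b≄a) =
    ⊑-trans y⊑b (⊑-trans b⊑a a⊑x) , λ x⊑y → b≄a (b⊑a , ⊑-trans a⊑x (⊑-trans x⊑y y⊑b))

  ⊏⇒cEdge : ∀ {x y} → y ⊏ x → CEdge G x y
  ⊏⇒cEdge (y⊑x , x⋢y) = _ , _ , ≃-refl , ≃-refl , y⊑x , λ (_ , x⊑y) → x⋢y x⊑y

  cPath⇔descending : ∀ {q} → CPath G q ⇔ AllPairs (λ x y → y ⊏ x) q
  cPath⇔descending = mk⇔
    (λ (_ , edges) → Linked⇒AllPairs (λ y⊏x z⊏y → ⊏-trans z⊏y y⊏x) (Linked.map cEdge⇒⊏ edges))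
    (λ descending → AllPairs.map (λ (_ , x⋢y) (x⊑y , _) → x⋢y x⊑y) descending ,
                    AllPairs⇒Linked (AllPairs.map ⊏⇒cEdge descending))

  powerPath⇒heavierCPath : ∀ {p} → PowerPath G p →
                           ∃[ q ] ∃[ w ] (CPath G q × PathWeight G q w × length p ≤ w)
  powerPath⇒heavierCPath {p} path =
    q , _ , Equivalence.from cPath⇔descending descending , concatMap-classOf-weight q ,
    unique⇒length≤ setoid (proj₁ path) (All.tabulate covered)
    where
    q : List Carrier
    q = deduplicate _≃?_ p

    descending : AllPairs (λ x y → y ⊏ x) q
    descending = AllPairs.map (λ ((_ , y⊑x) , x≄y) → y⊑x , λ x⊑y → x≄y (x⊑y , y⊑x))
                              (allPairs-deduplicate⁺ _≃?_ (Equivalence.to powerPath⇔allPairs path))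

    covered : ∀ {y} → y ∈ₚ p → y ∈ concatMap classOf q
    covered y∈p = ∈-concat⁺ setoid (Any.map⁺ (Any.map ∈-classOf
      (Any.deduplicate⁺ _≃?_ (λ b≃a y≃a → ≃-trans y≃a (≃-sym b≃a))
                             (Any.map (λ { ≡.refl → ≃-refl }) y∈p))))

  class⇒powerEdges : ∀ {x l} → All (_≃ x) l → AllPairs _≉_ l → AllPairs (PowerEdge G) l
  class⇒powerEdges []          []               = []
  class⇒powerEdges (a≃x ∷ l≃x) (a≉l ∷ distinct) =
    All.zipWith (λ (a≉b , (b⊑x , _)) → a≉b , ⊑-trans b⊑x (proj₂ a≃x)) (a≉l , l≃x)
    ∷ class⇒powerEdges l≃x distinct

  ≃-⊏-powerEdge : ∀ {a b x} → a ≃ x → b ⊏ x → PowerEdge G a b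
  ≃-⊏-powerEdge (_ , x⊑a) (b⊑x , x⋢b) =
    (λ a≈b → x⋢b (⊑-trans x⊑a (≈⇒⊑ a≈b))) , ⊑-trans b⊑x x⊑a

  ≃-⊏ : ∀ {b c x} → b ≃ c → c ⊏ x → b ⊏ x
  ≃-⊏ (b⊑c , _) (c⊑x , x⋢c) = ⊑-trans b⊑c c⊑x , λ x⊑b → x⋢c (⊑-trans x⊑b b⊑c)

  descending⇒powerEdges : ∀ {q w} → AllPairs (λ x y → y ⊏ x) q → PathWeight G q w →
                          ∃[ p ] (AllPairs (PowerEdge G) p × length p ≡ w × All (λ y → Any (y ≃_) q) p)
  descending⇒powerEdges []                 []      = [] , [] , ≡.refl , []
  descending⇒powerEdges {x ∷ q} (q⊏x ∷ descending) ((l , ≡.refl , l≃x , l-distinct , _) ∷ weight)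
    with descending⇒powerEdges descending weight
  ... | p , p-edges , ≡.refl , p≃q =
    l ++ p ,
    AllPairs.++⁺ (class⇒powerEdges l≃x l-distinct) p-edges
      (All.map (λ a≃x → All.map (λ b≃q → ≃-⊏-powerEdge a≃x (below b≃q)) p≃q) l≃x) ,
    length-++ l ,
    All.++⁺ (All.map here l≃x) (All.map there p≃q)
    where
    below : ∀ {b} → Any (b ≃_) q → b ⊏ x
    below = All.lookupWith (λ c⊏x b≃c → ≃-⊏ b≃c c⊏x) q⊏x

  cPath⇒powerPath : ∀ {q w} → CPath G q → PathWeight G q w → ∃[ p ] (PowerPath G p × length p ≡ w)
  cPath⇒powerPath path weight =
    let p , edges , length≡w , _ =
          descending⇒powerEdges (Equivalence.to cPath⇔descending path) weight
    in p , Equivalence.from powerPath⇔allPairs edges , length≡w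

  maxPowerPathLength⇒maxCPathWeight : ∀ {L} → IsMaxPowerPathLength G L → IsMaxCPathWeight G L
  maxPowerPathLength⇒maxCPathWeight ((p , path , ≡.refl) , longest) =
    attained (powerPath⇒heavierCPath path) , λ _ _ → weight≤L
    where
    weight≤L : ∀ {q w} → CPath G q → PathWeight G q w → w ≤ length p
    weight≤L cpath weight =
      let p′ , path′ , length≡w = cPath⇒powerPath cpath weight
      in ≡.subst (_≤ length p) length≡w (longest p′ path′)

    attained : ∃[ q ] ∃[ w ] (CPath G q × PathWeight G q w × length p ≤ w) →
               ∃[ q ] (CPath G q × PathWeight G q (length p))
    attained (q , w , cpath , weight , p≤w) =
      q , cpath , ≡.subst (PathWeight G q) (≤-antisym (weight≤L cpath weight) p≤w) weight

  longestPowerPath : ∃[ L ] IsMaxPowerPathLength G L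
  longestPowerPath =
    let L , (p , edges , length≡L) , longest = longest-chain powerEdge? powerEdge-resp proj₁
    in L , (p , Equivalence.from powerPath⇔allPairs edges , length≡L) ,
       λ p path → longest (Equivalence.to powerPath⇔allPairs path)
    where
    powerEdge? : Decidable (PowerEdge G)
    powerEdge? x y = ¬? (x ≟ y) ×-dec (y ⊑? x)

    powerEdge-resp : ∀ {x x′ y y′} → x ≈ x′ → y ≈ y′ → PowerEdge G x y → PowerEdge G x′ y′
    powerEdge-resp x≈x′ y≈y′ (x≉y , y⊑x) =
      (λ x′≈y′ → x≉y (trans x≈x′ (trans x′≈y′ (sym y≈y′)))) ,
      ⊑-trans (≈⇒⊑ (sym y≈y′)) (⊑-trans y⊑x (≈⇒⊑ x≈x′))

proposition9 : ∀ {c ℓ} (G : Group c ℓ) → IsFiniteGroup G →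
    ∃[ L ] (IsMaxCPathWeight G L × IsMaxPowerPathLength G L)
proposition9 G (_ , enumeration) =
  let L , longest = longestPowerPath in L , maxPowerPathLength⇒maxCPathWeight longest , longest
  where open FiniteGroup G enumeration
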